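{- Let $G$ be a connected finite simple graph with $\operatorname{im}(G)=t$, and suppose $G$ is not the complete graph $K_t$. Then for every $n\geq 5$, $\operatorname{im}(G\,\Box\, P_n)\geq t+2$.
   Context: All graphs are finite and simple. $P_n$ is the path on $n$ vertices. A graph $G$ has a $G'$-immersion if there is an injective map $\phi:V(G')\to V(G)$ such that for every edge $uv\in E(G')$ there is a path in $G$ joining $\phi(u)$ and $\phi(v)$, and these paths are pairwise edge-disjoint. The immersion number $\operatorname{im}(G)$ is the largest $t$ such that $G$ has a $K_t$-immersion. The Cartesian product $G\,\Box\, H$ has vertex set $V(G)\times V(H)$, with $(g,h)$ adjacent to $(g',h')$ iff $g=g'$ and $hh'\in E(H)$, or $gg'\in E(G)$ and $h=h'$. -}

module Defs where

open import Level using (0ℓ)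
open import Data.Nat as ℕ using (ℕ; suc; _≤_; _+_)
open import Data.Fin using (Fin; toℕ)
open import Data.Fin.Properties using (*↔×)
open import Data.Product using (Σ; ∃; ∃-syntax; _×_; _,_; proj₁; proj₂)
open import Data.Sum using (_⊎_)
open import Data.List using (List; []; _∷_)
open import Data.List.Membership.Propositional using (_∈_)
open import Data.List.Relation.Unary.Unique.Propositional using (Unique)
open import Data.Empty using (⊥)
open import Relation.Nullary using (¬_)
open import Relation.Binary.PropositionalEquality using (_≡_; _≢_)
open import Function using (Injective; _↔_; Inverse)
open import Function.Properties.Inverse using (↔-trans)
open import Data.Product.Function.NonDependent.Propositional using (_×-cong_)

record Graph : Set₁ where
  field
    V      : Set
    size   : ℕ
    enum   : Fin size ↔ V
    Adj    : V → V → Set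
    adj-sym : ∀ {u v} → Adj u v → Adj v u
    irrefl : ∀ {v} → ¬ Adj v v
open Graph public

data IsWalk (G : Graph) : V G → V G → List (V G) → Set where
  single : ∀ v → IsWalk G v v (v ∷ [])
  step   : ∀ {u w v vs} → Adj G u w → IsWalk G w v (w ∷ vs) → IsWalk G u v (u ∷ w ∷ vs)

IsPath : (G : Graph) → V G → V G → List (V G) → Set
IsPath G u v vs = IsWalk G u v vs × Unique vs

data Consec {A : Set} : A → A → List A → Set where
  here  : ∀ {a b xs} → Consec a b (a ∷ b ∷ xs)
  there : ∀ {a b x xs} → Consec a b xs → Consec a b (x ∷ xs)

UsesEdge : {A : Set} → A → A → List A → Set
UsesEdge a b vs = Consec a b vs ⊎ Consec b a vs

EdgeDisjoint : {A : Set} → List A → List A → Set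
EdgeDisjoint p q = ∀ a b → Consec a b p → UsesEdge a b q → ⊥

record KImmersion (G : Graph) (t : ℕ) : Set where
  field
    φ      : Fin t → V G
    φ-inj  : Injective _≡_ _≡_ φ
    path   : (i j : Fin t) → toℕ i ℕ.< toℕ j → List (V G)
    isPath : ∀ i j (p : toℕ i ℕ.< toℕ j) → IsPath G (φ i) (φ j) (path i j p)
    disj   : ∀ i j k l (p : toℕ i ℕ.< toℕ j) (q : toℕ k ℕ.< toℕ l) →
             ¬ (i ≡ k × j ≡ l) → EdgeDisjoint (path i j p) (path k l q)

HasKImmersion : Graph → ℕ → Set
HasKImmersion G t = KImmersion G t

ImmersionNumber : Graph → ℕ → Set
ImmersionNumber G t = HasKImmersion G t × (∀ s → HasKImmersion G s → s ≤ t)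

Connected : Graph → Set
Connected G = ∀ u v → ∃[ vs ] IsPath G u v vs

K : ℕ → Graph
K t = record
  { V = Fin t ; size = t ; enum = Function.Properties.Inverse.↔-refl
  ; Adj = λ i j → i ≢ j ; adj-sym = λ p q → p (Relation.Binary.PropositionalEquality.sym q)
  ; irrefl = λ p → p Relation.Binary.PropositionalEquality.refl }
  where import Function.Properties.Inverse
        import Relation.Binary.PropositionalEquality

record Iso (G H : Graph) : Set where
  field
    bij     : V G ↔ V H
    adj-iff : ∀ u v → (Adj G u v → Adj H (Inverse.to bij u) (Inverse.to bij v))
                    × (Adj H (Inverse.to bij u) (Inverse.to bij v) → Adj G u v)

P : ℕ → Graph
P n = record
  { V = Fin n ; size = n ; enum = Function.Properties.Inverse.↔-refl
  ; Adj = λ i j → (toℕ j ≡ suc (toℕ i)) ⊎ (toℕ i ≡ suc (toℕ j))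
  ; adj-sym = λ { (Data.Sum.inj₁ e) → Data.Sum.inj₂ e ; (Data.Sum.inj₂ e) → Data.Sum.inj₁ e }
  ; irrefl = irr }
  where
    import Function.Properties.Inverse
    import Data.Sum
    open import Data.Nat.Properties using (n<1+n; <-irrefl)
    n≢1+n-local : ∀ m → m ≢ suc m
    n≢1+n-local m e = <-irrefl e (n<1+n m)
    import Relation.Binary.PropositionalEquality as PE
    irr : ∀ {i : Fin n} → ¬ ((toℕ i ≡ suc (toℕ i)) ⊎ (toℕ i ≡ suc (toℕ i)))
    irr {i} (Data.Sum.inj₁ e) = n≢1+n-local (toℕ i) e
    irr {i} (Data.Sum.inj₂ e) = n≢1+n-local (toℕ i) e

_□_ : Graph → Graph → Graph
G □ H = record
  { V = V G × V H
  ; size = size G ℕ.* size H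
  ; enum = ↔-trans *↔× (enum G ×-cong enum H)
  ; Adj = λ x y → (proj₁ x ≡ proj₁ y × Adj H (proj₂ x) (proj₂ y))
                ⊎ (Adj G (proj₁ x) (proj₁ y) × proj₂ x ≡ proj₂ y)
  ; adj-sym = sy
  ; irrefl = ir }
  where
    import Relation.Binary.PropositionalEquality as PE
    import Data.Sum
    sy : ∀ {x y : V G × V H} →
         (proj₁ x ≡ proj₁ y × Adj H (proj₂ x) (proj₂ y)) ⊎ (Adj G (proj₁ x) (proj₁ y) × proj₂ x ≡ proj₂ y) →
         (proj₁ y ≡ proj₁ x × Adj H (proj₂ y) (proj₂ x)) ⊎ (Adj G (proj₁ y) (proj₁ x) × proj₂ y ≡ proj₂ x)
    sy (Data.Sum.inj₁ (e , a)) = Data.Sum.inj₁ (PE.sym e , adj-sym H a)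
    sy (Data.Sum.inj₂ (a , e)) = Data.Sum.inj₂ (adj-sym G a , PE.sym e)
    ir : ∀ {x : V G × V H} →
         ¬ ((proj₁ x ≡ proj₁ x × Adj H (proj₂ x) (proj₂ x)) ⊎ (Adj G (proj₁ x) (proj₁ x) × proj₂ x ≡ proj₂ x))
    ir (Data.Sum.inj₁ (_ , a)) = irrefl H a
    ir (Data.Sum.inj₂ (a , _)) = irrefl G a

module Submission where

-- Fix a K_t-immersion of G with branch vertices φ 0, …, φ (t-1).
--  * If every vertex of G is a branch vertex, then each φ i has, through the
--    first edges of its t-1 edge-disjoint paths, t-1 distinct neighbours, all
--    of them branch vertices; so G ≅ K_t, excluded by hypothesis.  Hence some
--    vertex v of G is not a branch vertex.
--  * In G □ Pₙ take the layers 0,…,4 of the path.  Branch vertices of the new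
--    immersion: (φ 0, 1), (φ 0, 3) and (φ i, 2) for every i.  Two vertices
--    (φ i, 2), (φ j, 2) are joined by the old path copied onto layer 2; the
--    hubs (φ 0, k), k ∈ {1,3}, reach (φ i, 2) along the old φ 0 – φ i path
--    copied onto layer k followed by one vertical edge; the two hubs are
--    joined by a bypass that descends to layer 0, runs to v, climbs the
--    column of v up to layer 4, returns to φ 0 and descends to layer 3.
--  Edge-disjointness is proved by classifying the edges of each path into an
--  "edge kind" and showing that the kinds of different paths never share an
--  edge.  This yields a K_{t+2}-immersion.

open import Defs
open import Data.Nat as ℕ using (ℕ; zero; suc; _≤_; _+_; s≤s; z≤n)
open import Data.Nat.Properties using (≤-reflexive; +-comm; <-irrefl; n<1+n)
open import Data.Fin as F using (Fin; toℕ; punchIn; punchOut) renaming (zero to fz; suc to fs)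
open import Data.Fin.Properties
  using (any?; all?; pigeonhole; punchIn-injective; punchInᵢ≢i; punchOut-injective; <-cmp)
open import Data.Product using (∃; ∃₂; ∃-syntax; _×_; _,_; proj₁; proj₂)
open import Data.Sum using (_⊎_; inj₁; inj₂; swap)
open import Data.List using (List; []; _∷_; _++_; map)
open import Data.List.Relation.Unary.All as All using (All; []; _∷_)
open import Data.List.Relation.Unary.All.Properties using (++⁺; map⁺)
open import Data.List.Relation.Unary.AllPairs using ([]; _∷_)
open import Data.List.Relation.Unary.Unique.Propositional using (Unique)
import Data.List.Relation.Unary.Unique.Propositional.Properties as Unique
open import Data.List.Relation.Binary.Disjoint.Propositional using (Disjoint)
open import Data.Empty using (⊥; ⊥-elim)
open import Relation.Binary.PropositionalEquality
open import Relation.Binary.Definitions using (tri<; tri≈; tri>)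
open import Relation.Nullary using (¬_; Dec; yes; no; ¬?)
open import Relation.Nullary.Decidable using (map′)
open import Function using (Inverse)
open import Function.Bundles using (mk↔ₛ′)

no-consec-singleton : ∀ {A : Set} {a b x : A} → ¬ Consec a b (x ∷ [])
no-consec-singleton (there ())

singleton-unique : ∀ {A : Set} {x : A} → Unique (x ∷ [])
singleton-unique = [] ∷ []

module Walks {G : Graph} where

  prepend : ∀ {u w z ys} → Adj G u w → IsWalk G w z ys → IsWalk G u z (u ∷ ys)
  prepend a (single w) = step a (single w)
  prepend a (step b r) = step a (step b r)

  concat : ∀ {u v w z xs ys} → IsWalk G u v xs → Adj G v w → IsWalk G w z ys →
           IsWalk G u z (xs ++ ys)
  concat (single _) a r = prepend a r
  concat (step b r) a r' = step b (concat r a r')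

  consec-∷ : ∀ {w z xs a b x} → IsWalk G w z xs → Consec a b (x ∷ xs) →
             (a ≡ x × b ≡ w) ⊎ Consec a b xs
  consec-∷ (single _) here = inj₁ (refl , refl)
  consec-∷ (step _ _) here = inj₁ (refl , refl)
  consec-∷ _ (there c) = inj₂ c

  consec-++ : ∀ {u v w z xs ys a b} → IsWalk G u v xs → IsWalk G w z ys →
              Consec a b (xs ++ ys) → Consec a b xs ⊎ ((a ≡ v × b ≡ w) ⊎ Consec a b ys)
  consec-++ (single _) r c with consec-∷ r c
  ... | inj₁ e = inj₂ (inj₁ e)
  ... | inj₂ c' = inj₂ (inj₂ c')
  consec-++ (step _ _) r here = inj₁ here
  consec-++ (step _ r') r (there c) with consec-++ r' r c
  ... | inj₁ c' = inj₁ (there c')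
  ... | inj₂ c' = inj₂ c'

  first-edge : ∀ {u v vs} → IsWalk G u v vs → u ≢ v → ∃ λ w → Adj G u w × Consec u w vs
  first-edge (single _) u≢v = ⊥-elim (u≢v refl)
  first-edge (step a _) _ = _ , a , here

  last-edge : ∀ {u v vs} → IsWalk G u v vs → u ≢ v → ∃ λ w → Adj G w v × Consec w v vs
  last-edge (single _) u≢v = ⊥-elim (u≢v refl)
  last-edge (step a r) _ = go a r
    where
      go : ∀ {u w v vs} → Adj G u w → IsWalk G w v vs → ∃ λ x → Adj G x v × Consec x v (u ∷ vs)
      go a (single _) = _ , a , here
      go a (step b r) with go b r
      ... | x , a' , c = x , a' , there c

module _ {A : Set} where

  record Covers (E : A → A → Set) (p : List A) : Set where
    constructor covering
    field covered : ∀ {a b} → Consec a b p → E a b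
  open Covers public

  covers-map : ∀ {E E' p} → (∀ {a b} → E a b → E' a b) → Covers E p → Covers E' p
  covers-map f cov = covering (λ c → f (covered cov c))

  Separated : (A → A → Set) → (A → A → Set) → Set
  Separated E E' = ∀ a b → E a b → E' a b ⊎ E' b a → ⊥

  covers-singleton : ∀ {E x} → Covers E (x ∷ [])
  covers-singleton = covering (λ c → ⊥-elim (no-consec-singleton c))

  edge-disjoint-sym : ∀ {p q : List A} → EdgeDisjoint p q → EdgeDisjoint q p
  edge-disjoint-sym d a b c (inj₁ c') = d a b c' (inj₁ c)
  edge-disjoint-sym d a b c (inj₂ c') = d b a c' (inj₂ c)

  no-common-edge : ∀ {p q : List A} {x y} → EdgeDisjoint p q → UsesEdge x y p → UsesEdge x y q → ⊥
  no-common-edge d (inj₁ c) u = d _ _ c u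
  no-common-edge d (inj₂ c) u = d _ _ c (swap u)

  disjoint-by-kinds : ∀ {E E' p q} → Covers E p → Covers E' q → Separated E E' → EdgeDisjoint p q
  disjoint-by-kinds cp cq s a b c (inj₁ c') = s a b (covered cp c) (inj₁ (covered cq c'))
  disjoint-by-kinds cp cq s a b c (inj₂ c') = s a b (covered cp c) (inj₂ (covered cq c'))

module _ {G : Graph} {E : V G → V G → Set} where
  open Walks

  covers-∷ : ∀ {x w z ys} → IsWalk G w z ys → E x w → Covers E ys → Covers E (x ∷ ys)
  covers-∷ {x} {ys = ys} r e cov = covering located
    where
      located : ∀ {a b} → Consec a b (x ∷ ys) → E a b
      located c with consec-∷ r c
      ... | inj₁ (refl , refl) = e
      ... | inj₂ c' = covered cov c'

  covers-++ : ∀ {u v w z xs ys} → IsWalk G u v xs → IsWalk G w z ys →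
              Covers E xs → E v w → Covers E ys → Covers E (xs ++ ys)
  covers-++ {xs = xs} {ys} r r' cov e cov' = covering located
    where
      located : ∀ {a b} → Consec a b (xs ++ ys) → E a b
      located c with consec-++ r r' c
      ... | inj₁ c' = covered cov c'
      ... | inj₂ (inj₁ (refl , refl)) = e
      ... | inj₂ (inj₂ c') = covered cov' c'

disjoint-by-All : ∀ {A : Set} {P Q : A → Set} {xs ys} →
                  All P xs → All Q ys → (∀ {y} → P y → Q y → ⊥) → Disjoint xs ys
disjoint-by-All ps qs clash (y∈xs , y∈ys) = clash (All.lookup ps y∈xs) (All.lookup qs y∈ys)

injective⇒onto : ∀ {n} (f : Fin n → Fin n) → (∀ {a b} → f a ≡ f b → a ≡ b) →
                 ∀ y → ∃ λ x → f x ≡ y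
injective⇒onto {zero} f inj ()
injective⇒onto {suc k} f inj y with any? (λ x → f x F.≟ y)
... | yes hit = hit
... | no miss = ⊥-elim (no-collision (pigeonhole (n<1+n k) (λ x → punchOut (avoids x))))
  where
    -- As f misses y, punchOut y ∘ f maps Fin (suc k) into Fin k, and
    -- pigeonhole's collision contradicts injectivity of f.
    avoids : ∀ x → y ≢ f x
    avoids x e = miss (x , sym e)
    no-collision : ¬ ∃₂ λ a b → a F.< b × punchOut (avoids a) ≡ punchOut (avoids b)
    no-collision (a , b , a<b , same) = <-irrefl (cong toℕ (inj (punchOut-injective (avoids a) (avoids b) same))) a<b

-- If every vertex of G is a branch vertex of a
-- K_{t+1}-immersion, the branch vertices are pairwise adjacent: the first
-- edges of the t paths leaving φ i are distinct (edge-disjointness) and end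
-- at t distinct branch vertices other than φ i, i.e. at all of them.
module Spanning {G : Graph} {t : ℕ} (I : KImmersion G (suc t)) where
  open KImmersion I
  open Walks

  record Departure (i j : Fin (suc t)) : Set where
    field
      next  : V G
      adj   : Adj G (φ i) next
      a b   : Fin (suc t)
      a<b   : toℕ a ℕ.< toℕ b
      joins : (a ≡ i × b ≡ j) ⊎ (a ≡ j × b ≡ i)
      used  : UsesEdge (φ i) next (path a b a<b)

  departure : ∀ i j → j ≢ i → Departure i j
  departure i j j≢i with <-cmp i j
  ... | tri< i<j _ _ with first-edge (proj₁ (isPath i j i<j)) (λ e → j≢i (sym (φ-inj e)))
  ...   | w , adj , c = record { next = w ; adj = adj ; a<b = i<j ; joins = inj₁ (refl , refl) ; used = inj₁ c }
  departure i j j≢i | tri≈ _ i≡j _ = ⊥-elim (j≢i (sym i≡j))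
  departure i j j≢i | tri> _ _ j<i with last-edge (proj₁ (isPath j i j<i)) (λ e → j≢i (φ-inj e))
  ...   | w , adj , c = record { next = w ; adj = adj-sym G adj ; a<b = j<i ; joins = inj₂ (refl , refl) ; used = inj₂ c }

  different-pairs : ∀ {i j k a b a' b' : Fin (suc t)} → j ≢ k →
                    (a ≡ i × b ≡ j) ⊎ (a ≡ j × b ≡ i) → (a' ≡ i × b' ≡ k) ⊎ (a' ≡ k × b' ≡ i) →
                    ¬ (a ≡ a' × b ≡ b')
  different-pairs j≢k (inj₁ (refl , refl)) (inj₁ (refl , refl)) (_ , e) = j≢k e
  different-pairs j≢k (inj₁ (refl , refl)) (inj₂ (refl , refl)) (e , e') = j≢k (trans e' e)
  different-pairs j≢k (inj₂ (refl , refl)) (inj₁ (refl , refl)) (e , e') = j≢k (trans e e')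
  different-pairs j≢k (inj₂ (refl , refl)) (inj₂ (refl , refl)) (e , _) = j≢k e

  departures-differ : ∀ {i j k} → j ≢ k → (d : Departure i j) (d' : Departure i k) →
                      Departure.next d ≢ Departure.next d'
  departures-differ {i} j≢k d d' same =
    no-common-edge (disj _ _ _ _ _ _ (different-pairs j≢k (Departure.joins d) (Departure.joins d')))
                   (Departure.used d)
                   (subst (λ w → UsesEdge (φ i) w (path _ _ (Departure.a<b d'))) (sym same) (Departure.used d'))

  module _ (ψ : V G → Fin (suc t)) (φψ : ∀ u → φ (ψ u) ≡ u) where

    branch-adjacent : ∀ i j → j ≢ i → Adj G (φ i) (φ j)
    branch-adjacent i j j≢i = subst (Adj G (φ i)) next≡φj (Departure.adj (dep m))
      where
        -- The departures towards the t indices other than i, renumbered by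
        -- punchIn, and where they lead (renumbered back by punchOut).
        dep : (m : Fin t) → Departure i (punchIn i m)
        dep m = departure i (punchIn i m) (punchInᵢ≢i i m)
        target≢i : ∀ m → i ≢ ψ (Departure.next (dep m))
        target≢i m e = irrefl G (subst (Adj G (φ i)) (sym (trans (cong φ e) (φψ _))) (Departure.adj (dep m)))
        target : Fin t → Fin t
        target m = punchOut (target≢i m)
        target-injective : ∀ {m m'} → target m ≡ target m' → m ≡ m'
        target-injective {m} {m'} e with punchIn i m F.≟ punchIn i m'
        ... | yes e' = punchIn-injective i m m' e'
        ... | no ne = ⊥-elim (departures-differ ne (dep m) (dep m')
                        (trans (sym (φψ _)) (trans (cong φ (punchOut-injective (target≢i m) (target≢i m') e)) (φψ _))))
        i≢j : i ≢ j
        i≢j e = j≢i (sym e)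
        hit : ∃ λ m → target m ≡ punchOut i≢j
        hit = injective⇒onto target target-injective (punchOut i≢j)
        m : Fin t
        m = proj₁ hit
        next≡φj : Departure.next (dep m) ≡ φ j
        next≡φj = trans (sym (φψ _)) (cong φ (punchOut-injective (target≢i m) i≢j (proj₂ hit)))

spanning-immersion-iso : ∀ {G t} (I : KImmersion G t) (ψ : V G → Fin t) →
                         (∀ u → KImmersion.φ I (ψ u) ≡ u) → Iso G (K t)
spanning-immersion-iso {G} {t} I ψ φψ = record
  { bij = mk↔ₛ′ ψ φ (λ i → φ-inj (φψ (φ i))) φψ
  ; adj-iff = λ u w → adjacent⇒distinct u w , distinct⇒adjacent t I ψ φψ u w }
  where
    open KImmersion I
    adjacent⇒distinct : ∀ u w → Adj G u w → ψ u ≢ ψ w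
    adjacent⇒distinct u w a e = irrefl G (subst (Adj G u) (sym (trans (sym (φψ u)) (trans (cong φ e) (φψ w)))) a)
    distinct⇒adjacent : ∀ t (I : KImmersion G t) (ψ : V G → Fin t) → (∀ u → KImmersion.φ I (ψ u) ≡ u) →
                        ∀ u w → ψ u ≢ ψ w → Adj G u w
    distinct⇒adjacent zero I ψ φψ u w _ with ψ u
    ... | ()
    distinct⇒adjacent (suc t) I ψ φψ u w ne =
      subst₂ (Adj G) (φψ u) (φψ w) (Spanning.branch-adjacent I ψ φψ (ψ u) (ψ w) (λ e → ne (sym e)))

module Enumerated (G : Graph) where
  to : Fin (size G) → V G
  to = Inverse.to (enum G)

  from : V G → Fin (size G)
  from = Inverse.from (enum G)

  to-from : ∀ u → to (from u) ≡ u
  to-from u = Inverse.inverseˡ (enum G) refl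

  _≟V_ : (u w : V G) → Dec (u ≡ w)
  u ≟V w = map′ (λ e → trans (sym (to-from u)) (trans (cong to e) (to-from w))) (cong from) (from u F.≟ from w)

  misses-or-onto : ∀ {t} (f : Fin t → V G) → (∃ λ x → ∀ i → f i ≢ x) ⊎ (∃ λ ψ → ∀ u → f (ψ u) ≡ u)
  misses-or-onto f with any? (λ x → all? (λ i → ¬? (f i ≟V to x)))
  ... | yes (x , missed) = inj₁ (to x , missed)
  ... | no covered = inj₂ ((λ u → proj₁ (preimage u)) , (λ u → proj₂ (preimage u)))
    where
      preimage : ∀ u → ∃ λ i → f i ≡ u
      preimage u with any? (λ i → f i ≟V u)
      ... | yes r = r
      ... | no h = ⊥-elim (covered (from u , λ i e → h (i , trans e (to-from u))))

module Layers {G : Graph} {N : ℕ} where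

  onLayer : Fin N → List (V G) → List (V G × Fin N)
  onLayer k = map (λ x → x , k)

  Horizontal : Fin N → List (V G) → V G × Fin N → V G × Fin N → Set
  Horizontal k p a b = proj₂ a ≡ k × proj₂ b ≡ k × Consec (proj₁ a) (proj₁ b) p

  onLayer-walk : ∀ {k u v p} → IsWalk G u v p → IsWalk (G □ P N) (u , k) (v , k) (onLayer k p)
  onLayer-walk (single v) = single _
  onLayer-walk (step a r) = step (inj₂ (a , refl)) (onLayer-walk r)

  onLayer-unique : ∀ {k p} → Unique p → Unique (onLayer k p)
  onLayer-unique = Unique.map⁺ (cong proj₁)

  onLayer-in-layer : ∀ k p → All (λ y → proj₂ y ≡ k) (onLayer k p)
  onLayer-in-layer k p = map⁺ (All.universal (λ _ → refl) p)

  OffLayer : Fin N → List (V G × Fin N) → Set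
  OffLayer k = All (λ y → proj₂ y ≢ k)

  onLayer-off : ∀ {k k' p} → k' ≢ k → OffLayer k' (onLayer k p)
  onLayer-off {k} {p = p} k'≢k = All.map (λ e e' → k'≢k (trans (sym e') e)) (onLayer-in-layer k p)

  fresh-by-layer : ∀ {x xs} → OffLayer (proj₂ x) xs → All (x ≢_) xs
  fresh-by-layer = All.map (λ ne e → ne (cong proj₂ (sym e)))

  onLayer-consec : ∀ {k a b} p → Consec a b (onLayer k p) → Horizontal k p a b
  onLayer-consec (x ∷ y ∷ p) here = refl , refl , here
  onLayer-consec (x ∷ p) (there c) with onLayer-consec p c
  ... | e , e' , c' = e , e' , there c'

  onLayer-horizontal : ∀ {k} p → Covers (Horizontal k p) (onLayer k p)
  onLayer-horizontal p = covering (onLayer-consec p)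

  horizontal-separated : ∀ {k k' p q} → EdgeDisjoint p q → Separated (Horizontal k p) (Horizontal k' q)
  horizontal-separated d a b (_ , _ , c) (inj₁ (_ , _ , c')) = d _ _ c (inj₁ c')
  horizontal-separated d a b (_ , _ , c) (inj₂ (_ , _ , c')) = d _ _ c (inj₂ c')

  onLayer-disjoint : ∀ {k k' p q} → EdgeDisjoint p q → EdgeDisjoint (onLayer k p) (onLayer k' q)
  onLayer-disjoint {p = p} {q} d = disjoint-by-kinds (onLayer-horizontal p) (onLayer-horizontal q) (horizontal-separated d)

  up : ∀ x {k k' : Fin N} → toℕ k' ≡ suc (toℕ k) → Adj (G □ P N) (x , k) (x , k')
  up x e = inj₁ (refl , inj₁ e)

  down : ∀ x {k k' : Fin N} → toℕ k ≡ suc (toℕ k') → Adj (G □ P N) (x , k) (x , k')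
  down x e = inj₁ (refl , inj₂ e)

module Construction {G : Graph} {t : ℕ} (m : ℕ) (I : KImmersion G (suc t))
    (v : V G) (v-free : ∀ i → KImmersion.φ I i ≢ v)
    (R : List (V G)) (R-path : IsPath G (KImmersion.φ I fz) v R)
    (R' : List (V G)) (R'-path : IsPath G v (KImmersion.φ I fz) R') where
  open KImmersion I
  open Walks
  open Layers {G} {5 + m}

  H : Graph
  H = G □ P (5 + m)

  l0 l1 l2 l3 l4 : Fin (5 + m)
  l0 = fz
  l1 = fs fz
  l2 = fs (fs fz)
  l3 = fs (fs (fs fz))
  l4 = fs (fs (fs (fs fz)))

  hub : V G
  hub = φ fz

  hub≢v : hub ≢ v
  hub≢v = v-free fz

  spoke : Fin (suc t) → List (V G)
  spoke fz = hub ∷ []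
  spoke (fs i) = path fz (fs i) (s≤s z≤n)

  spoke-path : ∀ i → IsPath G hub (φ i) (spoke i)
  spoke-path fz = single _ , singleton-unique
  spoke-path (fs i) = isPath fz (fs i) (s≤s z≤n)

  spokes-disjoint : ∀ {i j} → i ≢ j → EdgeDisjoint (spoke i) (spoke j)
  spokes-disjoint {fz} _ a b c _ = no-consec-singleton c
  spokes-disjoint {fs i} {fz} _ a b c (inj₁ c') = no-consec-singleton c'
  spokes-disjoint {fs i} {fz} _ a b c (inj₂ c') = no-consec-singleton c'
  spokes-disjoint {fs i} {fs j} i≢j = disj fz (fs i) fz (fs j) (s≤s z≤n) (s≤s z≤n) (λ { (_ , e) → i≢j e })

  ray : Fin (5 + m) → Fin (suc t) → List (V H)
  ray k i = onLayer k (spoke i) ++ (φ i , l2) ∷ []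

  ray-walk : ∀ {k} i → Adj H (φ i , k) (φ i , l2) → IsWalk H (hub , k) (φ i , l2) (ray k i)
  ray-walk i a = concat (onLayer-walk (proj₁ (spoke-path i))) a (single _)

  ray-unique : ∀ {k} i → k ≢ l2 → Unique (ray k i)
  ray-unique {k} i k≢l2 =
    Unique.++⁺ (onLayer-unique (proj₂ (spoke-path i))) singleton-unique
               (disjoint-by-All (onLayer-in-layer k (spoke i)) (onLayer-off {p = φ i ∷ []} k≢l2) (λ e ne → ne e))

  RayEdge : Fin (5 + m) → Fin (suc t) → V H → V H → Set
  RayEdge k i a b = Horizontal k (spoke i) a b ⊎ (proj₂ a ≡ k × b ≡ (φ i , l2))

  ray-covers : ∀ k i → Covers (RayEdge k i) (ray k i)
  ray-covers k i = covers-++ (onLayer-walk (proj₁ (spoke-path i))) (single _)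
                           (covers-map inj₁ (onLayer-horizontal (spoke i))) (inj₂ (refl , refl)) covers-singleton

  ray-start : ∀ {k i a b} → RayEdge k i a b → proj₂ a ≡ k
  ray-start (inj₁ (e , _ , _)) = e
  ray-start (inj₂ (e , _)) = e

  ray-end : ∀ {k i a b} → RayEdge k i a b → proj₂ b ≡ k ⊎ proj₂ b ≡ l2
  ray-end (inj₁ (_ , e , _)) = inj₁ e
  ray-end (inj₂ (_ , refl)) = inj₂ refl

  rays-same-layer : ∀ {k i j} → k ≢ l2 → i ≢ j → Separated (RayEdge k i) (RayEdge k j)
  rays-same-layer _ i≢j a b (inj₁ h) (inj₁ (inj₁ h')) = horizontal-separated (spokes-disjoint i≢j) a b h (inj₁ h')
  rays-same-layer _ i≢j a b (inj₁ h) (inj₂ (inj₁ h')) = horizontal-separated (spokes-disjoint i≢j) a b h (inj₂ h')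
  rays-same-layer k≢l2 _ a b (inj₁ (_ , e , _)) (inj₁ (inj₂ (_ , refl))) = k≢l2 (sym e)
  rays-same-layer k≢l2 _ a b (inj₁ (e , _ , _)) (inj₂ (inj₂ (_ , refl))) = k≢l2 (sym e)
  rays-same-layer k≢l2 _ a b (inj₂ (_ , refl)) (inj₁ (inj₁ (_ , e , _))) = k≢l2 (sym e)
  rays-same-layer _ i≢j a b (inj₂ (_ , refl)) (inj₁ (inj₂ (_ , e))) = i≢j (φ-inj (cong proj₁ e))
  rays-same-layer k≢l2 _ a b (inj₂ (_ , refl)) (inj₂ (inj₁ (e , _ , _))) = k≢l2 (sym e)
  rays-same-layer k≢l2 _ a b (inj₂ (_ , refl)) (inj₂ (inj₂ (e , _))) = k≢l2 (sym e)

  -- Rays from the two hub copies, at different layers k ≢ k': the start layer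
  -- of a ray edge is k, its end layer k or l2.
  rays-different-layers : ∀ {k k' i j} → k ≢ k' → k' ≢ l2 → Separated (RayEdge k i) (RayEdge k' j)
  rays-different-layers k≢k' _ a b e (inj₁ e') = k≢k' (trans (sym (ray-start e)) (ray-start e'))
  rays-different-layers k≢k' k'≢l2 a b e (inj₂ e') with ray-end e
  ... | inj₁ bk = k≢k' (trans (sym bk) (ray-start e'))
  ... | inj₂ b2 = k'≢l2 (trans (sym (ray-start e')) b2)

  -- Rays against layer-l2 copies of lists: a ray edge starts on layer k.
  rays-layer2 : ∀ {k i p} → k ≢ l2 → Separated (RayEdge k i) (Horizontal l2 p)
  rays-layer2 k≢l2 a b e (inj₁ (a2 , _)) = k≢l2 (trans (sym (ray-start e)) a2)
  rays-layer2 k≢l2 a b e (inj₂ (_ , a2 , _)) = k≢l2 (trans (sym (ray-start e)) a2)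

  homeward climb bypass : List (V H)
  homeward = onLayer l4 R' ++ (hub , l3) ∷ []
  climb = (v , l1) ∷ (v , l2) ∷ (v , l3) ∷ homeward
  bypass = (hub , l1) ∷ onLayer l0 R ++ climb

  homeward-walk : IsWalk H (v , l4) (hub , l3) homeward
  homeward-walk = concat (onLayer-walk (proj₁ R'-path)) (down hub refl) (single _)

  climb-walk : IsWalk H (v , l1) (hub , l3) climb
  climb-walk = step (up v refl) (step (up v refl) (prepend (up v refl) homeward-walk))

  bypass-walk : IsWalk H (hub , l1) (hub , l3) bypass
  bypass-walk = prepend (down hub refl) (concat (onLayer-walk (proj₁ R-path)) (up v refl) climb-walk)

  homeward-off : ∀ {k} → k ≢ l4 → k ≢ l3 → OffLayer k homeward
  homeward-off k≢l4 k≢l3 = ++⁺ (onLayer-off k≢l4) (onLayer-off {p = hub ∷ []} k≢l3)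

  homeward-unique : Unique homeward
  homeward-unique = Unique.++⁺ (onLayer-unique (proj₂ R'-path)) singleton-unique
                    (disjoint-by-All (onLayer-in-layer l4 R') (onLayer-off {p = hub ∷ []} (λ ())) (λ e ne → ne e))

  -- The vertices of the bypass are told apart by their layers, except that
  -- (v, l1) ≢ (hub, l1) and (v, l3) ≢ (hub, l3) because v is not a branch vertex.
  climb-unique : Unique climb
  climb-unique = fresh-by-layer ((λ ()) ∷ (λ ()) ∷ homeward-off (λ ()) (λ ()))
               ∷ fresh-by-layer ((λ ()) ∷ homeward-off (λ ()) (λ ()))
               ∷ ++⁺ (fresh-by-layer (onLayer-off (λ ()))) ((λ e → hub≢v (cong proj₁ (sym e))) ∷ [])
               ∷ homeward-unique

  bypass-unique : Unique bypass
  bypass-unique = ++⁺ (fresh-by-layer (onLayer-off (λ ())))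
                      ((λ e → hub≢v (cong proj₁ e)) ∷ fresh-by-layer ((λ ()) ∷ (λ ()) ∷ homeward-off (λ ()) (λ ())))
                ∷ Unique.++⁺ (onLayer-unique (proj₂ R-path)) climb-unique
                    (disjoint-by-All (onLayer-in-layer l0 R) climb-off-l0 (λ e ne → ne e))
    where
      climb-off-l0 : OffLayer l0 climb
      climb-off-l0 = (λ ()) ∷ (λ ()) ∷ (λ ()) ∷ homeward-off (λ ()) (λ ())

  Outer : V H → Set
  Outer x = proj₂ x ≡ l0 ⊎ proj₂ x ≡ l4

  BypassEdge : V H → V H → Set
  BypassEdge a b = Outer a ⊎ (Outer b ⊎ (proj₁ a ≡ v × proj₁ b ≡ v × proj₂ a ≢ proj₂ b))

  bypass-covers : Covers BypassEdge bypass
  bypass-covers = covers-∷ (concat (onLayer-walk (proj₁ R-path)) (up v refl) climb-walk)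
                    (inj₂ (inj₁ (inj₁ refl)))
                    (covers-++ (onLayer-walk (proj₁ R-path)) climb-walk
                               (covers-map (λ h → inj₁ (inj₁ (proj₁ h))) (onLayer-horizontal R)) (inj₁ (inj₁ refl)) climb-covers)
    where
      vertical : ∀ {k k'} → k ≢ k' → BypassEdge (v , k) (v , k')
      vertical k≢k' = inj₂ (inj₂ (refl , refl , k≢k'))
      homeward-covers : Covers BypassEdge homeward
      homeward-covers = covers-++ (onLayer-walk (proj₁ R'-path)) (single _)
                        (covers-map (λ h → inj₁ (inj₂ (proj₁ h))) (onLayer-horizontal R')) (inj₁ (inj₂ refl)) covers-singleton
      climb-covers : Covers BypassEdge climb
      climb-covers = covers-∷ (step (up v refl) (prepend (up v refl) homeward-walk)) (vertical (λ ()))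
                       (covers-∷ (prepend (up v refl) homeward-walk) (vertical (λ ()))
                         (covers-∷ homeward-walk (vertical (λ ())) homeward-covers))

  Inner : V H → Set
  Inner x = proj₂ x ≢ l0 × proj₂ x ≢ l4

  Avoids : V H → V H → Set
  Avoids a b = Inner a × Inner b × (proj₂ a ≡ proj₂ b ⊎ proj₁ b ≢ v)

  bypass-sym : ∀ {a b} → BypassEdge a b → BypassEdge b a
  bypass-sym (inj₁ o) = inj₂ (inj₁ o)
  bypass-sym (inj₂ (inj₁ o)) = inj₁ o
  bypass-sym (inj₂ (inj₂ (av , bv , ne))) = inj₂ (inj₂ (bv , av , λ e → ne (sym e)))

  outer-inner : ∀ x → Outer x → Inner x → ⊥
  outer-inner x (inj₁ e) (n0 , _) = n0 e
  outer-inner x (inj₂ e) (_ , n4) = n4 e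

  bypass-avoided : ∀ {a b} → BypassEdge a b → Avoids a b → ⊥
  bypass-avoided {a} (inj₁ o) (ia , _ , _) = outer-inner a o ia
  bypass-avoided {b = b} (inj₂ (inj₁ o)) (_ , ib , _) = outer-inner b o ib
  bypass-avoided (inj₂ (inj₂ (_ , _ , ne))) (_ , _ , inj₁ e) = ne e
  bypass-avoided (inj₂ (inj₂ (_ , bv , _))) (_ , _ , inj₂ b≢v) = b≢v bv

  bypass-separated : ∀ {E} → (∀ {a b} → E a b → Avoids a b) → Separated BypassEdge E
  bypass-separated avoids a b e (inj₁ e') = bypass-avoided e (avoids e')
  bypass-separated avoids a b e (inj₂ e') = bypass-avoided (bypass-sym e) (avoids e')

  inner-layer : ∀ {k} x → k ≢ l0 → k ≢ l4 → proj₂ x ≡ k → Inner x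
  inner-layer x k≢l0 k≢l4 refl = k≢l0 , k≢l4

  ray-avoids : ∀ {k i a b} → k ≢ l0 → k ≢ l4 → RayEdge k i a b → Avoids a b
  ray-avoids {a = a} {b} k0 k4 (inj₁ (ak , bk , _)) =
    inner-layer a k0 k4 ak , inner-layer b k0 k4 bk , inj₁ (trans ak (sym bk))
  ray-avoids {i = i} {a} k0 k4 (inj₂ (ak , refl)) = inner-layer a k0 k4 ak , ((λ ()) , (λ ())) , inj₂ (v-free i)

  layer2-avoids : ∀ {p a b} → Horizontal l2 p a b → Avoids a b
  layer2-avoids {a = a} {b} (a2 , b2 , _) =
    inner-layer a (λ ()) (λ ()) a2 , inner-layer b (λ ()) (λ ()) b2 , inj₁ (trans a2 (sym b2))

  bypass∥ray : ∀ k i → k ≢ l0 → k ≢ l4 → EdgeDisjoint bypass (ray k i)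
  bypass∥ray k i k≢l0 k≢l4 = disjoint-by-kinds bypass-covers (ray-covers k i) (bypass-separated (ray-avoids k≢l0 k≢l4))

  bypass∥layer2 : ∀ p → EdgeDisjoint bypass (onLayer l2 p)
  bypass∥layer2 p = disjoint-by-kinds bypass-covers (onLayer-horizontal p) (bypass-separated layer2-avoids)

  ray∥ray : ∀ k i j → k ≢ l2 → i ≢ j → EdgeDisjoint (ray k i) (ray k j)
  ray∥ray k i j k≢l2 i≢j = disjoint-by-kinds (ray-covers k i) (ray-covers k j) (rays-same-layer k≢l2 i≢j)

  ray∥ray-across : ∀ k k' i j → k ≢ k' → k' ≢ l2 → EdgeDisjoint (ray k i) (ray k' j)
  ray∥ray-across k k' i j k≢k' k'≢l2 = disjoint-by-kinds (ray-covers k i) (ray-covers k' j) (rays-different-layers k≢k' k'≢l2)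

  ray∥layer2 : ∀ k i p → k ≢ l2 → EdgeDisjoint (ray k i) (onLayer l2 p)
  ray∥layer2 k i p k≢l2 = disjoint-by-kinds (ray-covers k i) (onLayer-horizontal p) (rays-layer2 k≢l2)


  branch : Fin (3 + t) → V H
  branch fz = hub , l1
  branch (fs fz) = hub , l3
  branch (fs (fs i)) = φ i , l2

  branch-injective : ∀ {a b} → branch a ≡ branch b → a ≡ b
  branch-injective {fz} {fz} _ = refl
  branch-injective {fs fz} {fs fz} _ = refl
  branch-injective {fs (fs a)} {fs (fs b)} e = cong (λ i → fs (fs i)) (φ-inj (cong proj₁ e))
  branch-injective {fz} {fs fz} ()
  branch-injective {fz} {fs (fs _)} ()
  branch-injective {fs fz} {fz} ()
  branch-injective {fs fz} {fs (fs _)} ()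
  branch-injective {fs (fs _)} {fz} ()
  branch-injective {fs (fs _)} {fs fz} ()

  route : (i j : Fin (3 + t)) → toℕ i ℕ.< toℕ j → List (V H)
  route fz (fs fz) _ = bypass
  route fz (fs (fs j)) _ = ray l1 j
  route (fs fz) (fs (fs j)) _ = ray l3 j
  route (fs (fs i)) (fs (fs j)) (s≤s (s≤s i<j)) = onLayer l2 (path i j i<j)
  route (fs fz) (fs fz) (s≤s ())
  route (fs (fs i)) (fs fz) (s≤s ())

  route-path : ∀ i j (i<j : toℕ i ℕ.< toℕ j) → IsPath H (branch i) (branch j) (route i j i<j)
  route-path fz (fs fz) _ = bypass-walk , bypass-unique
  route-path fz (fs (fs j)) _ = ray-walk j (up _ refl) , ray-unique j (λ ())
  route-path (fs fz) (fs (fs j)) _ = ray-walk j (down _ refl) , ray-unique j (λ ())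
  route-path (fs (fs i)) (fs (fs j)) (s≤s (s≤s i<j)) =
    onLayer-walk (proj₁ (isPath i j i<j)) , onLayer-unique (proj₂ (isPath i j i<j))
  route-path (fs fz) (fs fz) (s≤s ())
  route-path (fs (fs i)) (fs fz) (s≤s ())

  route-disjoint : ∀ i j k l (i<j : toℕ i ℕ.< toℕ j) (k<l : toℕ k ℕ.< toℕ l) →
                   ¬ (i ≡ k × j ≡ l) → EdgeDisjoint (route i j i<j) (route k l k<l)
  route-disjoint fz (fs fz) fz (fs fz) _ _ ne = ⊥-elim (ne (refl , refl))
  route-disjoint fz (fs fz) fz (fs (fs l)) _ _ _ = bypass∥ray l1 l (λ ()) (λ ())
  route-disjoint fz (fs fz) (fs fz) (fs (fs l)) _ _ _ = bypass∥ray l3 l (λ ()) (λ ())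
  route-disjoint fz (fs fz) (fs (fs k)) (fs (fs l)) _ (s≤s (s≤s _)) _ = bypass∥layer2 _
  route-disjoint fz (fs (fs j)) fz (fs fz) _ _ _ = edge-disjoint-sym (bypass∥ray l1 j (λ ()) (λ ()))
  route-disjoint fz (fs (fs j)) fz (fs (fs l)) _ _ ne = ray∥ray l1 j l (λ ()) (λ e → ne (refl , cong (λ i → fs (fs i)) e))
  route-disjoint fz (fs (fs j)) (fs fz) (fs (fs l)) _ _ _ = ray∥ray-across l1 l3 j l (λ ()) (λ ())
  route-disjoint fz (fs (fs j)) (fs (fs k)) (fs (fs l)) _ (s≤s (s≤s _)) _ = ray∥layer2 l1 j _ (λ ())
  route-disjoint (fs fz) (fs (fs j)) fz (fs fz) _ _ _ = edge-disjoint-sym (bypass∥ray l3 j (λ ()) (λ ()))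
  route-disjoint (fs fz) (fs (fs j)) fz (fs (fs l)) _ _ _ = ray∥ray-across l3 l1 j l (λ ()) (λ ())
  route-disjoint (fs fz) (fs (fs j)) (fs fz) (fs (fs l)) _ _ ne = ray∥ray l3 j l (λ ()) (λ e → ne (refl , cong (λ i → fs (fs i)) e))
  route-disjoint (fs fz) (fs (fs j)) (fs (fs k)) (fs (fs l)) _ (s≤s (s≤s _)) _ = ray∥layer2 l3 j _ (λ ())
  route-disjoint (fs (fs i)) (fs (fs j)) fz (fs fz) (s≤s (s≤s _)) _ _ = edge-disjoint-sym (bypass∥layer2 _)
  route-disjoint (fs (fs i)) (fs (fs j)) fz (fs (fs l)) (s≤s (s≤s _)) _ _ = edge-disjoint-sym (ray∥layer2 l1 l _ (λ ()))
  route-disjoint (fs (fs i)) (fs (fs j)) (fs fz) (fs (fs l)) (s≤s (s≤s _)) _ _ = edge-disjoint-sym (ray∥layer2 l3 l _ (λ ()))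
  route-disjoint (fs (fs i)) (fs (fs j)) (fs (fs k)) (fs (fs l)) (s≤s (s≤s i<j)) (s≤s (s≤s k<l)) ne =
    onLayer-disjoint (disj i j k l i<j k<l (λ { (e , e') → ne (cong (λ i → fs (fs i)) e , cong (λ i → fs (fs i)) e') }))
  route-disjoint (fs fz) (fs fz) _ _ (s≤s ()) _ _
  route-disjoint (fs (fs i)) (fs fz) _ _ (s≤s ()) _ _
  route-disjoint _ _ (fs fz) (fs fz) _ (s≤s ()) _
  route-disjoint _ _ (fs (fs k)) (fs fz) _ (s≤s ()) _

  immersion : KImmersion H (3 + t)
  immersion = record { φ = branch ; φ-inj = branch-injective ; path = route ; isPath = route-path ; disj = route-disjoint }

single-vertex-immersion : ∀ {G} → V G → KImmersion G 1
single-vertex-immersion v = record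
  { φ = λ _ → v ; φ-inj = λ { {fz} {fz} _ → refl }
  ; path = λ { fz fz () } ; isPath = λ { fz fz () } ; disj = λ { fz fz _ _ () _ _ } }

extend-immersion : ∀ {G t} → Connected G → (I : KImmersion G (suc t)) →
                   ∀ v → (∀ i → KImmersion.φ I i ≢ v) → ∀ n → 5 ≤ n → HasKImmersion (G □ P n) (3 + t)
extend-immersion {G} conn I v v-free _ (s≤s (s≤s (s≤s (s≤s (s≤s (z≤n {m})))))) =
  Construction.immersion m I v v-free (proj₁ outward) (proj₂ outward) (proj₁ inward) (proj₂ inward)
  where
    outward : ∃ λ R → IsPath G (KImmersion.φ I fz) v R
    outward = conn (KImmersion.φ I fz) v
    inward : ∃ λ R → IsPath G v (KImmersion.φ I fz) R
    inward = conn v (KImmersion.φ I fz)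

-- Either the branch vertices of a maximum immersion cover G, and G ≅ K_t, or
-- some vertex v is free; then t ≥ 1 (v alone is a K_1-immersion) and the
-- construction gives a K_{t+2}-immersion of G □ Pₙ.
theorem11 : (G : Graph) (t : ℕ) → Connected G → ImmersionNumber G t → ¬ Iso G (K t) →
    (n : ℕ) → 5 ≤ n → ∃[ s ] (t + 2 ≤ s × HasKImmersion (G □ P n) s)
theorem11 G t conn (I , maximal) G≇Kt n 5≤n with Enumerated.misses-or-onto G (KImmersion.φ I)
... | inj₂ (ψ , φψ) = ⊥-elim (G≇Kt (spanning-immersion-iso I ψ φψ))
theorem11 G zero conn (I , maximal) G≇Kt n 5≤n | inj₁ (v , _) with maximal 1 (single-vertex-immersion v)
... | ()
theorem11 G (suc t) conn (I , maximal) G≇Kt n 5≤n | inj₁ (v , v-free) =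
  3 + t , ≤-reflexive (+-comm (suc t) 2) , extend-immersion conn I v v-free n 5≤n
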